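{- Let $\eta=(\eta_0,\ldots,\eta_n)$, $n>0$, be a partial orbit in a meet-tree with pseudo-period $u$. Then $u$ is also the pseudo-period of the reversed partial orbit $\eta^{ -1}=(\eta_n,\eta_{n-1},\ldots,\eta_0)$, i.e.\ $u$ is the smallest $m_0>0$ such that $\eta_{n-m_0}\mathbin{\wedge}\eta_n=\max_{0<m\leq n}\eta_n\mathbin{\wedge}\eta_{n-m}$.
   Context: A meet-tree is a structure $(A,\leq,\mathbin{\wedge})$ where $\leq$ is a partial order such that each $A_{\leq a}=\{x:x\leq a\}$ is linearly ordered, any two elements have a common lower bound, and $a\mathbin{\wedge} b$ is the largest element of $A_{\leq a}\cap A_{\leq b}$. A partial orbit is a finite sequence $(\eta_0,\ldots,\eta_n)$ such that $\eta_i\mapsto\eta_{i+1}$ ($i<n$) is a partial automorphism (preserves quantifier-free types in $\{\leq,\mathbin{\wedge}\}$); its reverse is again a partial orbit. For $n>0$, the pseudo-period of $\eta$ is the smallest $u>0$ such that $\eta_0\mathbin{\wedge}\eta_u=\max_{0<i\leq n}\eta_0\mathbin{\wedge}\eta_i$ (these meets lie in the chain below $\eta_0$). -}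

module Defs where

open import Level using (Level; _⊔_; suc)
open import Data.Nat as ℕ using (ℕ; _∸_) renaming (_≤_ to _≤ℕ_; _<_ to _<ℕ_; suc to sucℕ)
open import Data.Fin using (Fin; toℕ)
open import Data.Product using (Σ; _×_; ∃)
open import Data.Sum using (_⊎_)
open import Relation.Nullary using (¬_)
open import Relation.Binary.PropositionalEquality using (_≡_)
open import Relation.Binary.Structures using (IsPartialOrder)
open import Function.Bundles using (_⇔_)

record MeetTree (a ℓ : Level) : Set (suc (a ⊔ ℓ)) where
  infix 4 _≤_
  infixl 7 _∧_
  field
    Carrier        : Set a
    _≤_            : Carrier → Carrier → Set ℓ
    _∧_            : Carrier → Carrier → Carrier
    isPartialOrder : IsPartialOrder _≡_ _≤_
    downset-linear : ∀ a x y → x ≤ a → y ≤ a → (x ≤ y ⊎ y ≤ x)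
    common-lower   : ∀ x y → ∃ λ c → c ≤ x × c ≤ y
    ∧-lower₁       : ∀ x y → x ∧ y ≤ x
    ∧-lower₂       : ∀ x y → x ∧ y ≤ y
    ∧-greatest     : ∀ x y c → c ≤ x → c ≤ y → c ≤ x ∧ y

-- Terms of the language {∧} in k variables (used to express quantifier-free types).
data Term (k : ℕ) : Set where
  var  : Fin k → Term k
  _∧ₜ_ : Term k → Term k → Term k

module _ {a ℓ} (T : MeetTree a ℓ) where
  open MeetTree T

  eval : ∀ {k} → (Fin k → Carrier) → Term k → Carrier
  eval ρ (var i)  = ρ i
  eval ρ (s ∧ₜ t) = eval ρ s ∧ eval ρ t

  SameQFType : ∀ {k} → (Fin k → Carrier) → (Fin k → Carrier) → Set (a ⊔ ℓ)
  SameQFType ρ σ = ∀ s t →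
    ((eval ρ s ≡ eval ρ t) ⇔ (eval σ s ≡ eval σ t)) ×
    ((eval ρ s ≤ eval ρ t) ⇔ (eval σ s ≤ eval σ t))

  -- (η₀,…,ηₙ) (only the values η 0 … η n matter) is a partial orbit:
  -- ηᵢ ↦ ηᵢ₊₁ (i < n) is a partial automorphism, i.e. (η₀,…,ηₙ₋₁) and
  -- (η₁,…,ηₙ) have the same quantifier-free type.
  IsPartialOrbit : ℕ → (ℕ → Carrier) → Set (a ⊔ ℓ)
  IsPartialOrbit n η = SameQFType (λ (i : Fin n) → η (toℕ i)) (λ i → η (sucℕ (toℕ i)))

  MaxMeetAt : ℕ → (ℕ → Carrier) → ℕ → Set ℓ
  MaxMeetAt n η u = ∀ i → 0 <ℕ i → i ≤ℕ n → η 0 ∧ η i ≤ η 0 ∧ η u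

  IsPseudoPeriod : ℕ → (ℕ → Carrier) → ℕ → Set ℓ
  IsPseudoPeriod n η u =
    0 <ℕ u × u ≤ℕ n × MaxMeetAt n η u ×
    (∀ v → 0 <ℕ v → v <ℕ u → ¬ MaxMeetAt n η v)

reverseSeq : ∀ {a} {A : Set a} → ℕ → (ℕ → A) → (ℕ → A)
reverseSeq n η i = η (n ∸ i)

-- In a meet-tree the meets x ∧ y behave like an ultrametric: of the three
-- meets among x, y, z the two smallest coincide.  Translating along the
-- orbit preserves comparisons between meets, so minimality of u says that
-- η₀ splits off from η_u strictly below every η_{u-k}, 0 < k < u, and by
-- induction on k (stepping back by u) η₀ splits off from η_{k+u} no higher
-- than η_k does.  Translating these two facts to the top of the orbit gives
-- exactly the maximality and minimality of u for the reversed orbit.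
module Submission where

open import Defs
open import Data.Nat using (ℕ; _<_; zero; suc; _+_; _∸_; _≤_; _≤?_; z<s)
open import Data.Nat.Properties
open import Data.Nat.Induction using (<-rec)
open import Data.Fin using (fromℕ<)
open import Data.Fin.Properties using (toℕ-fromℕ<)
open import Data.Product using (_,_; proj₂)
open import Data.Sum using (_⊎_; inj₁; inj₂)
open import Relation.Nullary using (¬_; Dec; yes; no; contradiction)
open import Relation.Binary.PropositionalEquality using (_≡_; refl; sym; trans; cong; subst; module ≡-Reasoning)
open import Relation.Binary.Structures using (IsPartialOrder)
open import Function.Bundles using (_⇔_; Equivalence)
open import Function.Construct.Identity using (⇔-id)
open import Function.Construct.Composition using (_⇔-∘_)

[m∸n]+[n∸o]≡m∸o : ∀ {m n o} → o ≤ n → n ≤ m → (m ∸ n) + (n ∸ o) ≡ m ∸ o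
[m∸n]+[n∸o]≡m∸o {m} {n} {o} o≤n n≤m = begin
  (m ∸ n) + (n ∸ o)  ≡⟨ +-∸-assoc (m ∸ n) o≤n ⟨
  (m ∸ n) + n ∸ o    ≡⟨ cong (_∸ o) (m∸n+n≡m n≤m) ⟩
  m ∸ o              ∎
  where open ≡-Reasoning

module MeetTreeProperties {a ℓ} (T : MeetTree a ℓ) where
  open MeetTree T renaming (_≤_ to _⊑_)
  open IsPartialOrder isPartialOrder using (antisym) renaming (trans to ⊑-trans)

  ∧-comm : ∀ x y → x ∧ y ≡ y ∧ x
  ∧-comm x y = antisym (swap x y) (swap y x)
    where
    swap : ∀ x y → x ∧ y ⊑ y ∧ x
    swap x y = ∧-greatest y x (x ∧ y) (∧-lower₂ x y) (∧-lower₁ x y)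

  ∧-comparable : ∀ x y z → x ∧ y ⊑ x ∧ z ⊎ x ∧ z ⊑ x ∧ y
  ∧-comparable x y z = downset-linear x (x ∧ y) (x ∧ z) (∧-lower₁ x y) (∧-lower₁ x z)

  ∧-ultrametric : ∀ x y z → x ∧ y ⊑ x ∧ z → x ∧ y ⊑ y ∧ z
  ∧-ultrametric x y z x∧y⊑x∧z =
    ∧-greatest y z (x ∧ y) (∧-lower₂ x y) (⊑-trans x∧y⊑x∧z (∧-lower₂ x z))

module PartialOrbit {a ℓ} (T : MeetTree a ℓ) (n : ℕ) (η : ℕ → MeetTree.Carrier T)
                    (orbit : IsPartialOrbit T n η) where
  open MeetTree T renaming (_≤_ to _⊑_)

  -- Seen from η p, the point η r is at least as close as η q.
  infix 4 _≼[_]_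
  _≼[_]_ : ℕ → ℕ → ℕ → Set ℓ
  q ≼[ p ] r = η p ∧ η q ⊑ η p ∧ η r

  orbit-step : ∀ {p q r} → p < n → q < n → r < n →
               q ≼[ p ] r ⇔ suc q ≼[ suc p ] suc r
  orbit-step p<n q<n r<n
    with proj₂ (orbit (var (fromℕ< p<n) ∧ₜ var (fromℕ< q<n)) (var (fromℕ< p<n) ∧ₜ var (fromℕ< r<n)))
  ... | equiv rewrite toℕ-fromℕ< p<n | toℕ-fromℕ< q<n | toℕ-fromℕ< r<n = equiv

  orbit-shift : ∀ s {p q r} → s + p ≤ n → s + q ≤ n → s + r ≤ n →
                q ≼[ p ] r ⇔ s + q ≼[ s + p ] s + r
  orbit-shift zero    _   _   _   = ⇔-id _
  orbit-shift (suc s) p≤n q≤n r≤n =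
    orbit-step p≤n q≤n r≤n ⇔-∘ orbit-shift s (<⇒≤ p≤n) (<⇒≤ q≤n) (<⇒≤ r≤n)

  orbit-shift-to : ∀ s {p q r p′ q′ r′} → s + p ≡ p′ → s + q ≡ q′ → s + r ≡ r′ →
                   p′ ≤ n → q′ ≤ n → r′ ≤ n → q ≼[ p ] r ⇔ q′ ≼[ p′ ] r′
  orbit-shift-to s refl refl refl = orbit-shift s

  module PseudoPeriod {u : ℕ} (0<u : 0 < u) (u≤n : u ≤ n) (maxAt-u : MaxMeetAt T n η u)
                      (minimal : ∀ v → 0 < v → v < u → ¬ MaxMeetAt T n η v) where
    open MeetTreeProperties T
    open IsPartialOrder isPartialOrder using () renaming (refl to ⊑-refl; trans to ⊑-trans)

    ¬0≼[u]interior : ∀ {k} → 0 < k → k < u → ¬ (0 ≼[ u ] (u ∸ k))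
    ¬0≼[u]interior {k} 0<k k<u 0≼u∸k =
      minimal (u ∸ k) (m<n⇒0<n∸m k<u) (∸-monoʳ-< 0<k (<⇒≤ k<u))
        (λ i 0<i i≤n → ⊑-trans (maxAt-u i 0<i i≤n) η₀∧ηᵤ⊑η₀∧ηᵤ₋ₖ)
      where
      η₀∧ηᵤ⊑η₀∧ηᵤ₋ₖ : η 0 ∧ η u ⊑ η 0 ∧ η (u ∸ k)
      η₀∧ηᵤ⊑η₀∧ηᵤ₋ₖ = subst (_⊑ η 0 ∧ η (u ∸ k)) (∧-comm (η u) (η 0))
                        (∧-ultrametric (η u) (η 0) (η (u ∸ k)) 0≼u∸k)

    interior≼[u]0 : ∀ {k} → 0 < k → k < u → (u ∸ k) ≼[ u ] 0
    interior≼[u]0 {k} 0<k k<u with ∧-comparable (η u) (η (u ∸ k)) (η 0)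
    ... | inj₁ u∸k≼0 = u∸k≼0
    ... | inj₂ 0≼u∸k = contradiction 0≼u∸k (¬0≼[u]interior 0<k k<u)

    0≼-via-period : ∀ {k} → k + u ≤ n → u ≼[ k + u ] k → 0 ≼[ k + u ] k
    0≼-via-period {k} k+u≤n u≼k = ⊑-trans 0≼u u≼k
      where
      0≼u : 0 ≼[ k + u ] u
      0≼u = subst (_⊑ η (k + u) ∧ η u) (∧-comm (η 0) (η (k + u)))
              (∧-ultrametric (η 0) (η (k + u)) (η u)
                (maxAt-u (k + u) (<-≤-trans 0<u (m≤n+m u k)) k+u≤n))

    0≼[k+u]k : ∀ k → k + u ≤ n → 0 ≼[ k + u ] k
    0≼[k+u]k = <-rec _ go
      where
      go : ∀ k → (∀ {j} → j < k → j + u ≤ n → 0 ≼[ j + u ] j) → k + u ≤ n → 0 ≼[ k + u ] k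
      go zero    _  _     = ⊑-refl
      go (suc k) ih k+u≤n = 0≼-via-period k+u≤n (u≼[k+u]k (u ≤? suc k))
        where
        k≤n : suc k ≤ n
        k≤n = ≤-trans (m≤m+n (suc k) u) k+u≤n

        u≼[k+u]k : Dec (u ≤ suc k) → u ≼[ suc k + u ] suc k
        u≼[k+u]k (yes u≤k) =
          Equivalence.to
            (orbit-shift-to u (trans (cong (u +_) j+u≡k) (+-comm u (suc k))) (+-identityʳ u)
               (trans (+-comm u j) j+u≡k) k+u≤n u≤n k≤n)
            (ih (∸-monoʳ-< 0<u u≤k) (subst (_≤ n) (sym j+u≡k) k≤n))
          where
          j = suc k ∸ u
          j+u≡k : j + u ≡ suc k
          j+u≡k = m∸n+n≡m u≤k
        u≼[k+u]k (no u≰k) =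
          Equivalence.to
            (orbit-shift-to (suc k) refl (m+[n∸m]≡n (<⇒≤ (≰⇒> u≰k))) (+-identityʳ (suc k))
               k+u≤n u≤n k≤n)
            (interior≼[u]0 z<s (≰⇒> u≰k))

    reverse-maxMeetAt : MaxMeetAt T n (reverseSeq n η) u
    reverse-maxMeetAt i 0<i i≤n with u ≤? i
    ... | no u≰i =
      Equivalence.to
        (orbit-shift-to (n ∸ u) (m∸n+n≡m u≤n) ([m∸n]+[n∸o]≡m∸o (<⇒≤ (≰⇒> u≰i)) u≤n) (+-identityʳ _)
           ≤-refl (m∸n≤m n i) (m∸n≤m n u))
        (interior≼[u]0 0<i (≰⇒> u≰i))
    ... | yes u≤i =
      Equivalence.to
        (orbit-shift-to (n ∸ i) (m∸n+n≡m i≤n) (+-identityʳ _) ([m∸n]+[n∸o]≡m∸o u≤i i≤n)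
           ≤-refl (m∸n≤m n i) (m∸n≤m n u))
        (subst (λ t → 0 ≼[ t ] (i ∸ u)) (m∸n+n≡m u≤i)
           (0≼[k+u]k (i ∸ u) (subst (_≤ n) (sym (m∸n+n≡m u≤i)) i≤n)))

    reverse-minimal : ∀ v → 0 < v → v < u → ¬ MaxMeetAt T n (reverseSeq n η) v
    reverse-minimal v 0<v v<u maxAt-v =
      ¬0≼[u]interior 0<v v<u
        (Equivalence.from
          (orbit-shift-to (n ∸ u) (m∸n+n≡m u≤n) (+-identityʳ _) ([m∸n]+[n∸o]≡m∸o (<⇒≤ v<u) u≤n)
             ≤-refl (m∸n≤m n u) (m∸n≤m n v))
          (maxAt-v u 0<u u≤n))

proposition5p12 : ∀ {a ℓ} (T : MeetTree a ℓ) (n : ℕ) (η : ℕ → MeetTree.Carrier T) (u : ℕ) →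
    0 < n → IsPartialOrbit T n η → IsPseudoPeriod T n η u →
    IsPseudoPeriod T n (reverseSeq n η) u
proposition5p12 T n η u _ orbit (0<u , u≤n , maxAt-u , minimal) =
  0<u , u≤n , reverse-maxMeetAt , reverse-minimal
  where open PartialOrbit T n η orbit
        open PseudoPeriod 0<u u≤n maxAt-u minimal
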